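{- Let $\sigma$ be a cyclic permutation of $[n]$ and let $\mathcal{G}$ be an antichain of intervals along $\sigma$ such that $|\mathcal{G}|=n-1$ and $\mathcal{G}$ contains intervals of at least two different sizes. Then $\mathcal{G}$ is pair-contiguous.
   Context: A cyclic permutation of $[n]$ is an arrangement of $1,\dots,n$ around a circle; write its elements in circular order as $a_1,a_2,\dots,a_n$ (indices mod $n$). An interval along $\sigma$ is a nonempty set of circularly consecutive elements; $A_i^j=\{a_i,a_{i+1},\dots,a_{i+j-1}\}$ (indices mod $n$). A collection $\mathcal{G}$ of intervals along $\sigma$ is pair-contiguous if, for some $i$, $j$ and $s$, it consists exactly of the intervals $A_i^j,A_{i+1}^j,\dots,A_{i+s}^j,A_{i+s+1}^{j+1},A_{i+s+2}^{j+1},\dots,A_{i-2}^{j+1}$ (indices mod $n$); equivalently, it is an antichain of size $n-1$ that is the union of two collections of circularly consecutive intervals of sizes $j$ and $j+1$ respectively. -}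

module Defs where

open import Data.Nat using (ℕ; zero; suc; _≤_; _<_; _∸_)
open import Data.Nat.DivMod using (_mod_)
open import Data.Fin using (Fin; toℕ)
open import Data.Fin.Subset using (Subset; ⊥; ⁅_⁆; _∪_; _⊆_; ∣_∣)
open import Data.Fin.Permutation using (Permutation′; _⟨$⟩ʳ_)
open import Data.List using (List)
open import Data.List.Membership.Propositional using (_∈_)
open import Data.List.Relation.Unary.Unique.Propositional using (Unique)
open import Data.List using (length)
open import Data.Product using (Σ; ∃; _×_; _,_)
open import Data.Bool using (if_then_else_)
open import Data.Nat using (_≤ᵇ_)
open import Relation.Binary.PropositionalEquality using (_≡_; _≢_)
open import Function.Bundles using (_⇔_)

-- A cyclic permutation of [n] (elements of [n] are represented by Fin n)
-- is given by listing its elements in circular order a_0, ..., a_{n-1}: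
-- a_i = σ ⟨$⟩ʳ i.  Positions are taken mod n.

next : ∀ {n} → Fin n → Fin n
next {suc m} i = suc (toℕ i) mod suc m

shift : ∀ {n} → Fin n → ℕ → Fin n
shift i zero    = i
shift i (suc k) = next (shift i k)

elt : ∀ {n} → Permutation′ n → Fin n → Fin n
elt σ i = σ ⟨$⟩ʳ i

A : ∀ {n} → Permutation′ n → Fin n → ℕ → Subset n
A σ i zero    = ⊥
A σ i (suc j) = ⁅ elt σ (shift i j) ⁆ ∪ A σ i j

IsInterval : ∀ {n} → Permutation′ n → Subset n → Set
IsInterval {n} σ S = Σ (Fin n) λ i → Σ ℕ λ j → (1 ≤ j) × (j ≤ n) × (S ≡ A σ i j)

record IntervalCollection {n} (σ : Permutation′ n) : Set where
  field
    members    : List (Subset n)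
    unique     : Unique members
    intervals  : ∀ {S} → S ∈ members → IsInterval σ S

open IntervalCollection public

_∈ᶜ_ : ∀ {n} {σ : Permutation′ n} → Subset n → IntervalCollection σ → Set
S ∈ᶜ G = S ∈ members G

card : ∀ {n} {σ : Permutation′ n} → IntervalCollection σ → ℕ
card G = length (members G)

IsAntichain : ∀ {n} {σ : Permutation′ n} → IntervalCollection σ → Set
IsAntichain G = ∀ {S T} → S ∈ᶜ G → T ∈ᶜ G → S ⊆ T → S ≡ T

HasTwoSizes : ∀ {n} {σ : Permutation′ n} → IntervalCollection σ → Set
HasTwoSizes G = Σ _ λ S → Σ _ λ T → S ∈ᶜ G × T ∈ᶜ G × ∣ S ∣ ≢ ∣ T ∣

-- The t-th interval (0 ≤ t ≤ n-2) of the pair-contiguous family with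
-- parameters i, j, s:  A_{i+t}^j for t ≤ s, and A_{i+t}^{j+1} for t > s.
pcMember : ∀ {n} → Permutation′ n → Fin n → ℕ → ℕ → ℕ → Subset n
pcMember σ i j s t = A σ (shift i t) (if t ≤ᵇ s then j else suc j)

-- G is pair-contiguous: for some i, j, s it consists exactly of the intervals
-- A_i^j, A_{i+1}^j, ..., A_{i+s}^j, A_{i+s+1}^{j+1}, ..., A_{i-2}^{j+1}
-- (i.e. A_{i+t}^{..} for 0 ≤ t ≤ n-2, with both blocks nonempty:
-- 0 ≤ s and s+1 ≤ n-2), where the intervals are nonempty (1 ≤ j, j+1 ≤ n).
IsPairContiguous : ∀ {n} {σ : Permutation′ n} → IntervalCollection σ → Set
IsPairContiguous {n} {σ} G =
  Σ (Fin n) λ i → Σ ℕ λ j → Σ ℕ λ s →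
    (1 ≤ j) × (suc j ≤ n) × (suc s ≤ n ∸ 2) ×
    (∀ S → (S ∈ᶜ G) ⇔ (∃ λ t → (t < n ∸ 1) × (S ≡ pcMember σ i j s t)))

-- No two intervals of the antichain G start at the same position, so the
-- n − 1 starting positions miss exactly one position h of the circle.  Let
-- ℓ t be the length of the interval starting at h + 1 + t, for t ≤ n − 2.
-- If ℓ t > ℓ (t + 1), the interval starting one step later would lie inside
-- the one at h + 1 + t; so ℓ is nondecreasing.  In the same way the interval
-- at h + 1, two steps after h − 1, forces ℓ (n − 2) ≤ ℓ 0 + 1.  Hence ℓ takes
-- only the values ℓ 0 and ℓ 0 + 1, the smaller ones first.
module Submission where

open import Defs
open import Data.Nat using (ℕ; zero; suc; _+_; _∸_; _≤_; _<_; z≤n; s≤s; s≤s⁻¹; _%_; _≤ᵇ_)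
open import Data.Nat.Properties
open import Data.Nat.DivMod using (m<n⇒m%n≡m; [m+n]%n≡m%n; %-distribˡ-+; m%n%n≡m%n; m%n<n)
open import Data.Fin as Fin using (Fin; toℕ; punchOut)
open import Data.Fin.Properties using (toℕ-fromℕ<; toℕ-injective; toℕ<n; ¬Fin0; any?; ¬∀⟶∃¬; punchOut-injective; <⇒notInjective)
open import Data.Fin.Subset using (Subset; ⁅_⁆; _∪_; _⊆_; ∣_∣; _∈_; _∉_; inside; outside)
open import Data.Fin.Subset.Properties using (x∈p∪q⁻; p⊆p∪q; q⊆p∪q; x∈⁅x⁆; x∈⁅y⁆⇒x≡y; ∉⊥; ∣⊥∣≡0; ∪-identityˡ)
open import Data.Fin.Permutation using (Permutation′; _⟨$⟩ˡ_; inverseˡ)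
open import Data.Vec.Base using (_∷_; here; there)
open import Data.List using (List; lookup)
open import Data.List.Membership.Propositional using () renaming (_∈_ to _∈ₗ_)
open import Data.List.Membership.Propositional.Properties using (∈-lookup; ∈-length)
open import Data.List.Relation.Unary.All as All using ()
open import Data.List.Relation.Unary.AllPairs using (_∷_)
open import Data.List.Relation.Unary.Any using (index)
open import Data.List.Relation.Unary.Any.Properties using (lookup-index)
open import Data.List.Relation.Unary.Unique.Propositional using (Unique)
open import Data.Bool using (true; false; if_then_else_)
open import Data.Unit using (tt)
open import Data.Product using (∃; _×_; _,_; proj₁; proj₂)
open import Data.Sum using (inj₁; inj₂)
open import Data.Empty using (⊥-elim)
open import Function.Base using (_∘_)
open import Function.Bundles using (_⇔_; mk⇔; Equivalence)
open import Function.Definitions using (Injective)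
open import Relation.Nullary using (¬_; Dec; yes; no; contradiction)
open import Relation.Binary.PropositionalEquality

toℕ-shift : ∀ {m} (i : Fin (suc m)) k → toℕ (shift i k) ≡ (toℕ i + k) % suc m
toℕ-shift {m} i zero = begin
  toℕ i             ≡⟨ m<n⇒m%n≡m (toℕ<n i) ⟨
  toℕ i % N         ≡⟨ cong (_% N) (+-identityʳ (toℕ i)) ⟨
  (toℕ i + 0) % N   ∎
  where open ≡-Reasoning
        N : ℕ
        N = suc m
toℕ-shift {m} i (suc k) = begin
  toℕ (next (shift i k))             ≡⟨ toℕ-fromℕ< (m%n<n (suc (toℕ (shift i k))) N) ⟩
  suc (toℕ (shift i k)) % N          ≡⟨ cong (λ x → suc x % N) (toℕ-shift i k) ⟩
  (1 + (toℕ i + k) % N) % N          ≡⟨ %-distribˡ-+ 1 ((toℕ i + k) % N) N ⟩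
  (1 % N + (toℕ i + k) % N % N) % N  ≡⟨ cong (λ x → (1 % N + x) % N) (m%n%n≡m%n (toℕ i + k) N) ⟩
  (1 % N + (toℕ i + k) % N) % N      ≡⟨ %-distribˡ-+ 1 (toℕ i + k) N ⟨
  (1 + (toℕ i + k)) % N              ≡⟨ cong (_% N) (+-suc (toℕ i) k) ⟨
  (toℕ i + suc k) % N                ∎
  where open ≡-Reasoning
        N : ℕ
        N = suc m

shift-shift : ∀ {n} (i : Fin n) d k → shift (shift i d) k ≡ shift i (k + d)
shift-shift i d zero    = refl
shift-shift i d (suc k) = cong next (shift-shift i d k)

shift-period : ∀ {m} (i : Fin (suc m)) → shift i (suc m) ≡ i
shift-period {m} i = toℕ-injective (begin
  toℕ (shift i (suc m))  ≡⟨ toℕ-shift i (suc m) ⟩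
  (toℕ i + suc m) % suc m ≡⟨ [m+n]%n≡m%n (toℕ i) (suc m) ⟩
  toℕ i % suc m           ≡⟨ m<n⇒m%n≡m (toℕ<n i) ⟩
  toℕ i                   ∎)
  where open ≡-Reasoning

shift-≢ : ∀ {m} (i : Fin (suc m)) {d} → 0 < d → d < suc m → shift i d ≢ i
shift-≢ {m} i {d} 0<d d<N shift≡i with toℕ i + d <? suc m
... | yes no-wrap = <⇒≢ (m<m+n (toℕ i) 0<d) (begin
  toℕ i               ≡⟨ cong toℕ shift≡i ⟨
  toℕ (shift i d)     ≡⟨ toℕ-shift i d ⟩
  (toℕ i + d) % suc m ≡⟨ m<n⇒m%n≡m no-wrap ⟩
  toℕ i + d           ∎)
  where open ≡-Reasoning
-- After wrapping around, shift i d is toℕ i + d − N, which is below toℕ i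
... | no wrap = <⇒≢ r<i (begin
  r                   ≡⟨ m<n⇒m%n≡m (<-≤-trans r<i (<⇒≤ (toℕ<n i))) ⟨
  r % N               ≡⟨ [m+n]%n≡m%n r N ⟨
  (r + N) % N         ≡⟨ cong (_% N) r+N≡i+d ⟩
  (toℕ i + d) % N     ≡⟨ toℕ-shift i d ⟨
  toℕ (shift i d)     ≡⟨ cong toℕ shift≡i ⟩
  toℕ i               ∎)
  where
  open ≡-Reasoning
  N : ℕ
  N = suc m
  r : ℕ
  r = toℕ i + d ∸ N
  r+N≡i+d : r + N ≡ toℕ i + d
  r+N≡i+d = m∸n+n≡m (≮⇒≥ wrap)
  r<i : r < toℕ i
  r<i = +-cancelʳ-< N r (toℕ i) (subst (_< toℕ i + N) (sym r+N≡i+d) (+-monoʳ-< (toℕ i) d<N))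

shift-surjective : ∀ {m} (i j : Fin (suc m)) → ∃ λ k → k < suc m × shift i k ≡ j
shift-surjective {m} i j with toℕ i ≤? toℕ j
... | yes i≤j = toℕ j ∸ toℕ i , ≤-<-trans (m∸n≤m (toℕ j) (toℕ i)) (toℕ<n j) ,
  toℕ-injective (begin
    toℕ (shift i (toℕ j ∸ toℕ i))    ≡⟨ toℕ-shift i _ ⟩
    (toℕ i + (toℕ j ∸ toℕ i)) % suc m ≡⟨ cong (_% suc m) (m+[n∸m]≡n i≤j) ⟩
    toℕ j % suc m                    ≡⟨ m<n⇒m%n≡m (toℕ<n j) ⟩
    toℕ j                            ∎)
  where open ≡-Reasoning
... | no i≰j = k , k<N , toℕ-injective (begin
    toℕ (shift i k)     ≡⟨ toℕ-shift i k ⟩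
    (toℕ i + k) % N     ≡⟨ cong (_% N) i+k≡j+N ⟩
    (toℕ j + N) % N     ≡⟨ [m+n]%n≡m%n (toℕ j) N ⟩
    toℕ j % N           ≡⟨ m<n⇒m%n≡m (toℕ<n j) ⟩
    toℕ j               ∎)
  where
  open ≡-Reasoning
  N : ℕ
  N = suc m
  i≤N : toℕ i ≤ N
  i≤N = <⇒≤ (toℕ<n i)
  k : ℕ
  k = N ∸ toℕ i + toℕ j
  k<N : k < N
  k<N = subst (k <_) (m∸n+n≡m i≤N) (+-monoʳ-< (N ∸ toℕ i) (≰⇒> i≰j))
  i+k≡j+N : toℕ i + k ≡ toℕ j + N
  i+k≡j+N = begin
    toℕ i + (N ∸ toℕ i + toℕ j)  ≡⟨ +-assoc (toℕ i) (N ∸ toℕ i) (toℕ j) ⟨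
    toℕ i + (N ∸ toℕ i) + toℕ j  ≡⟨ cong (_+ toℕ j) (m+[n∸m]≡n i≤N) ⟩
    N + toℕ j                    ≡⟨ +-comm N (toℕ j) ⟩
    toℕ j + N                    ∎

elt-injective : ∀ {n} (σ : Permutation′ n) → Injective _≡_ _≡_ (elt σ)
elt-injective σ {i} {j} eq = begin
  i                         ≡⟨ inverseˡ σ ⟨
  σ ⟨$⟩ˡ (elt σ i)          ≡⟨ cong (σ ⟨$⟩ˡ_) eq ⟩
  σ ⟨$⟩ˡ (elt σ j)          ≡⟨ inverseˡ σ ⟩
  j                         ∎
  where open ≡-Reasoning

∈-A⁻ : ∀ {n} (σ : Permutation′ n) i j {x} → x ∈ A σ i j → ∃ λ k → k < j × x ≡ elt σ (shift i k)
∈-A⁻ σ i zero x∈ = contradiction x∈ ∉⊥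
∈-A⁻ σ i (suc j) x∈ with x∈p∪q⁻ ⁅ elt σ (shift i j) ⁆ (A σ i j) x∈
... | inj₁ x∈⁅a⁆ = j , ≤-refl , x∈⁅y⁆⇒x≡y _ x∈⁅a⁆
... | inj₂ x∈A with ∈-A⁻ σ i j x∈A
...   | k , k<j , x≡a = k , m≤n⇒m≤1+n k<j , x≡a

∈-A⁺ : ∀ {n} (σ : Permutation′ n) i j {k} → k < j → elt σ (shift i k) ∈ A σ i j
∈-A⁺ σ i (suc j) k<1+j with m≤n⇒m<n∨m≡n (s≤s⁻¹ k<1+j)
... | inj₁ k<j  = q⊆p∪q ⁅ elt σ (shift i j) ⁆ (A σ i j) (∈-A⁺ σ i j k<j)
... | inj₂ refl = p⊆p∪q (A σ i j) (x∈⁅x⁆ _)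

A-shift-⊆ : ∀ {n} (σ : Permutation′ n) i d {l l′} → d + l′ ≤ l → A σ (shift i d) l′ ⊆ A σ i l
A-shift-⊆ σ i d {l} {l′} d+l′≤l x∈ with ∈-A⁻ σ (shift i d) l′ x∈
... | k , k<l′ , refl = subst (_∈ A σ i l) (cong (elt σ) (sym (shift-shift i d k)))
  (∈-A⁺ σ i l (≤-trans (subst (_≤ d + l′) (+-comm d (suc k)) (+-monoʳ-≤ d k<l′)) d+l′≤l))

next-∉-A : ∀ {m} (σ : Permutation′ (suc m)) i {j} → j < suc m → elt σ (shift i j) ∉ A σ i j
next-∉-A σ i {j} j<N x∈ with ∈-A⁻ σ i j x∈
... | k , k<j , eq = shift-≢ (shift i k) (m<n⇒0<n∸m k<j) (≤-<-trans (m∸n≤m j k) j<N) (begin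
  shift (shift i k) (j ∸ k)  ≡⟨ shift-shift i k (j ∸ k) ⟩
  shift i (j ∸ k + k)        ≡⟨ cong (shift i) (m∸n+n≡m (<⇒≤ k<j)) ⟩
  shift i j                  ≡⟨ elt-injective σ eq ⟩
  shift i k                  ∎)
  where open ≡-Reasoning

∣⁅x⁆∪p∣ : ∀ {n} {x : Fin n} {p : Subset n} → x ∉ p → ∣ ⁅ x ⁆ ∪ p ∣ ≡ suc ∣ p ∣
∣⁅x⁆∪p∣ {x = Fin.zero}  {inside ∷ p}  x∉ = contradiction here x∉
∣⁅x⁆∪p∣ {x = Fin.zero}  {outside ∷ p} x∉ = cong (suc ∘ ∣_∣) (∪-identityˡ p)
∣⁅x⁆∪p∣ {x = Fin.suc x} {inside ∷ p}  x∉ = cong suc (∣⁅x⁆∪p∣ (x∉ ∘ there))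
∣⁅x⁆∪p∣ {x = Fin.suc x} {outside ∷ p} x∉ = ∣⁅x⁆∪p∣ (x∉ ∘ there)

∣A∣ : ∀ {m} (σ : Permutation′ (suc m)) i {j} → j ≤ suc m → ∣ A σ i j ∣ ≡ j
∣A∣ {m} σ i {zero}  _   = ∣⊥∣≡0 (suc m)
∣A∣     σ i {suc j} j<N = trans (∣⁅x⁆∪p∣ (next-∉-A σ i j<N)) (cong suc (∣A∣ σ i (<⇒≤ j<N)))

Unique-lookup-injective : ∀ {A : Set} {xs : List A} → Unique xs → Injective _≡_ _≡_ (lookup xs)
Unique-lookup-injective (_ ∷ _)   {Fin.zero}  {Fin.zero}  _  = refl
Unique-lookup-injective (x≢ ∷ _)  {Fin.zero}  {Fin.suc j} eq = ⊥-elim (All.lookup x≢ (∈-lookup j) eq)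
Unique-lookup-injective (x≢ ∷ _)  {Fin.suc i} {Fin.zero}  eq = ⊥-elim (All.lookup x≢ (∈-lookup i) (sym eq))
Unique-lookup-injective (_ ∷ xs!) {Fin.suc i} {Fin.suc j} eq = cong Fin.suc (Unique-lookup-injective xs! eq)

-- Punching both missed points out would inject Fin (1 + m) into Fin m.
injective-misses-≤1 : ∀ {m} {f : Fin m → Fin (suc m)} → Injective _≡_ _≡_ f →
  ∀ {p q} → (∀ k → f k ≢ p) → (∀ k → f k ≢ q) → p ≡ q
injective-misses-≤1 {zero} _ {Fin.zero} {Fin.zero} _ _ = refl
injective-misses-≤1 {suc m} {f} f-inj {p} {q} p∉ q∉ with p Fin.≟ q
... | yes p≡q = p≡q
... | no p≢q  = ⊥-elim (<⇒notInjective (n<1+n m) g-injective)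
  where
  p≢f : ∀ k → p ≢ f k
  p≢f k = p∉ k ∘ sym
  q′≢f′ : ∀ k → punchOut p≢q ≢ punchOut (p≢f k)
  q′≢f′ k eq = q∉ k (sym (punchOut-injective p≢q (p≢f k) eq))
  g : Fin (suc m) → Fin m
  g k = punchOut (q′≢f′ k)
  g-injective : Injective _≡_ _≡_ g
  g-injective eq = f-inj (punchOut-injective (p≢f _) (p≢f _) (punchOut-injective (q′≢f′ _) (q′≢f′ _) eq))

injection-misses-exactly-one : ∀ {m n} {f : Fin m → Fin n} → Injective _≡_ _≡_ f → n ≡ suc m →
  ∃ λ h → (∀ k → f k ≢ h) × (∀ p → p ≢ h → ∃ λ k → f k ≡ p)
injection-misses-exactly-one {m} {f = f} f-inj refl = h , h-missed , hit
  where
  hit? : ∀ p → Dec (∃ λ k → f k ≡ p)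
  hit? p = any? (λ k → f k Fin.≟ p)
  not-surjective : ¬ (∀ p → ∃ λ k → f k ≡ p)
  not-surjective hit = <⇒notInjective {f = proj₁ ∘ hit} (n<1+n m)
    (λ eq → trans (sym (proj₂ (hit _))) (trans (cong f eq) (proj₂ (hit _))))
  missed : ∃ λ h → ¬ ∃ λ k → f k ≡ h
  missed = ¬∀⟶∃¬ (suc m) _ hit? not-surjective
  h : Fin (suc m)
  h = proj₁ missed
  h-missed : ∀ k → f k ≢ h
  h-missed k eq = proj₂ missed (k , eq)
  hit : ∀ p → p ≢ h → ∃ λ k → f k ≡ p
  hit p p≢h with hit? p
  ... | yes p-hit = p-hit
  ... | no p-missed = contradiction (injective-misses-≤1 f-inj (λ k eq → p-missed (k , eq)) h-missed) p≢h

pcLength : ℕ → ℕ → ℕ → ℕ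
pcLength j s t = if t ≤ᵇ s then j else suc j

pcLength-≤ : ∀ {j s t} → t ≤ s → pcLength j s t ≡ j
pcLength-≤ {j} {s} {t} t≤s with t ≤ᵇ s | ≤⇒≤ᵇ t≤s
... | true | _ = refl

pcLength-> : ∀ {j s t} → s < t → pcLength j s t ≡ suc j
pcLength-> {j} {s} {t} s<t with t ≤ᵇ s | ≤ᵇ⇒≤ t s
... | true  | t≤s = contradiction (t≤s tt) (<⇒≱ s<t)
... | false | _   = refl

NondecreasingUpTo : (ℕ → ℕ) → ℕ → Set
NondecreasingUpTo ℓ M = ∀ {t} → t < M → ℓ t ≤ ℓ (suc t)

nondecreasing-mono : ∀ {ℓ M} → NondecreasingUpTo ℓ M → ∀ {a b} → a ≤ b → b ≤ M → ℓ a ≤ ℓ b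
nondecreasing-mono step {b = zero} z≤n _ = ≤-refl
nondecreasing-mono step {a} {suc b} a≤1+b 1+b≤M with m≤n⇒m<n∨m≡n a≤1+b
... | inj₁ a<1+b = ≤-trans (nondecreasing-mono step (s≤s⁻¹ a<1+b) (<⇒≤ 1+b≤M)) (step 1+b≤M)
... | inj₂ refl  = ≤-refl

pcLength-profile : ∀ ℓ M → NondecreasingUpTo ℓ M → ℓ M ≤ suc (ℓ 0) → ℓ M ≢ ℓ 0 →
  ∃ λ s → s < M × (∀ {t} → t ≤ M → ℓ t ≡ pcLength (ℓ 0) s t)
pcLength-profile ℓ zero _ _ ℓ0≢ℓ0 = contradiction refl ℓ0≢ℓ0
pcLength-profile ℓ (suc M) step growth ℓ[1+M]≢ℓ0 with ℓ M ≟ ℓ 0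
... | yes ℓM≡ℓ0 = M , ≤-refl , profile
  where
  profile : ∀ {t} → t ≤ suc M → ℓ t ≡ pcLength (ℓ 0) M t
  profile {t} t≤1+M with m≤n⇒m<n∨m≡n t≤1+M
  ... | inj₁ t<1+M = trans
    (≤-antisym (subst (ℓ t ≤_) ℓM≡ℓ0 (nondecreasing-mono step (s≤s⁻¹ t<1+M) (n≤1+n M)))
               (nondecreasing-mono step z≤n (<⇒≤ t<1+M)))
    (sym (pcLength-≤ (s≤s⁻¹ t<1+M)))
  ... | inj₂ refl = trans
    (≤-antisym growth (≤∧≢⇒< (subst (_≤ ℓ (suc M)) ℓM≡ℓ0 (step ≤-refl)) (ℓ[1+M]≢ℓ0 ∘ sym)))
    (sym (pcLength-> {s = M} ≤-refl))
... | no ℓM≢ℓ0 with pcLength-profile ℓ M (step ∘ m<n⇒m<1+n) (≤-trans (step ≤-refl) growth) ℓM≢ℓ0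
...   | s , s<M , profile = s , m<n⇒m<1+n s<M , profile′
  where
  profile′ : ∀ {t} → t ≤ suc M → ℓ t ≡ pcLength (ℓ 0) s t
  profile′ t≤1+M with m≤n⇒m<n∨m≡n t≤1+M
  ... | inj₁ t<1+M = profile (s≤s⁻¹ t<1+M)
  ... | inj₂ refl = trans
    (≤-antisym growth (subst (_≤ ℓ (suc M)) (trans (profile ≤-refl) (pcLength-> s<M)) (step ≤-refl)))
    (sym (pcLength-> (m<n⇒m<1+n s<M)))

module StartingPositions {M} (σ : Permutation′ (suc (suc M))) (G : IntervalCollection σ)
  (antichain : IsAntichain G) (card≡ : card G ≡ suc M) where

  private
    Position : Set
    Position = Fin (suc (suc M))
    Index : Set
    Index = Fin (card G)
    L : List (Subset (suc (suc M)))
    L = members G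

  interval : (k : Index) → IsInterval σ (lookup L k)
  interval k = intervals G (∈-lookup k)

  start : Index → Position
  start k = proj₁ (interval k)

  size : Index → ℕ
  size k = proj₁ (proj₂ (interval k))

  size-bounds : ∀ k → 1 ≤ size k × size k ≤ suc (suc M)
  size-bounds k = let _ , _ , 1≤size , size≤n , _ = interval k in 1≤size , size≤n

  lookup≡A : ∀ k → lookup L k ≡ A σ (start k) (size k)
  lookup≡A k = let _ , _ , _ , _ , eq = interval k in eq

  ∣lookup∣ : ∀ k → ∣ lookup L k ∣ ≡ size k
  ∣lookup∣ k = trans (cong ∣_∣ (lookup≡A k)) (∣A∣ σ (start k) (proj₂ (size-bounds k)))

  shifted-⊆⇒≡ : ∀ {k k′} d → start k′ ≡ shift (start k) d → d + size k′ ≤ size k →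
    lookup L k′ ≡ lookup L k
  shifted-⊆⇒≡ {k} {k′} d eq d+size′≤size = antichain (∈-lookup k′) (∈-lookup k)
    (subst₂ _⊆_ (sym (lookup≡A k′)) (sym (lookup≡A k))
      (subst (λ i → A σ i (size k′) ⊆ A σ (start k) (size k)) (sym eq)
        (A-shift-⊆ σ (start k) d d+size′≤size)))

  size-bound : ∀ {k k′} d → start k′ ≡ shift (start k) (suc d) → size k ≤ d + size k′
  size-bound {k} {k′} d eq with size k ≤? d + size k′
  ... | yes size≤ = size≤
  ... | no size≰ = contradiction (subst (d + size k′ <_) (sym same-size) (≰⇒> size≰)) (m+n≮n d (size k′))
    where
    same-size : size k′ ≡ size k
    same-size = begin
      size k′              ≡⟨ ∣lookup∣ k′ ⟨
      ∣ lookup L k′ ∣      ≡⟨ cong ∣_∣ (shifted-⊆⇒≡ (suc d) eq (≰⇒> size≰)) ⟩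
      ∣ lookup L k ∣       ≡⟨ ∣lookup∣ k ⟩
      size k               ∎
      where open ≡-Reasoning

  start-injective : Injective _≡_ _≡_ start
  start-injective {k} {k′} eq with ≤-total (size k) (size k′)
  ... | inj₁ size≤size′ = Unique-lookup-injective (unique G) (shifted-⊆⇒≡ 0 eq size≤size′)
  ... | inj₂ size′≤size = sym (Unique-lookup-injective (unique G) (shifted-⊆⇒≡ 0 (sym eq) size′≤size))

  private
    missing : ∃ λ h → (∀ k → start k ≢ h) × (∀ p → p ≢ h → ∃ λ k → start k ≡ p)
    missing = injection-misses-exactly-one start-injective (cong suc (sym card≡))

  hole : Position
  hole = proj₁ missing

  pos : ℕ → Position
  pos t = shift (next hole) t

  pos≡shift-hole : ∀ t → pos t ≡ shift hole (suc t)
  pos≡shift-hole t = trans (shift-shift hole 1 t) (cong (shift hole) (+-comm t 1))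

  pos-hit : ∀ {t} → t ≤ M → ∃ λ k → start k ≡ pos t
  pos-hit {t} t≤M = proj₂ (proj₂ missing) (pos t) λ pos≡hole →
    shift-≢ hole (s≤s z≤n) (s≤s (s≤s t≤M)) (trans (sym (pos≡shift-hole t)) pos≡hole)

  start-pos : ∀ k → ∃ λ t → t ≤ M × start k ≡ pos t
  start-pos k with shift-surjective hole (start k)
  ... | zero  , _     , hole≡start = contradiction (sym hole≡start) (proj₁ (proj₂ missing) k)
  ... | suc t , t+1<n , shift≡start =
    t , s≤s⁻¹ (s≤s⁻¹ t+1<n) , trans (sym shift≡start) (sym (pos≡shift-hole t))

  sizeAt : Position → ℕ
  sizeAt p with any? (λ k → start k Fin.≟ p)
  ... | yes (k , _) = size k
  ... | no _        = 0

  sizeAt-start : ∀ k → sizeAt (start k) ≡ size k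
  sizeAt-start k with any? (λ k′ → start k′ Fin.≟ start k)
  ... | yes (k′ , eq) = cong size (start-injective eq)
  ... | no none       = contradiction (k , refl) none

  ℓ : ℕ → ℕ
  ℓ t = sizeAt (pos t)

  ℓ≡size : ∀ t {k} → start k ≡ pos t → ℓ t ≡ size k
  ℓ≡size t {k} eq = trans (cong sizeAt (sym eq)) (sizeAt-start k)

  ℓ-bounds : ∀ {t} → t ≤ M → 1 ≤ ℓ t × ℓ t ≤ suc (suc M)
  ℓ-bounds {t} t≤M with pos-hit t≤M
  ... | k , eq = subst (λ l → 1 ≤ l × l ≤ suc (suc M)) (sym (ℓ≡size t eq)) (size-bounds k)

  ℓ-nondecreasing : NondecreasingUpTo ℓ M
  ℓ-nondecreasing {t} t<M with pos-hit (<⇒≤ t<M) | pos-hit t<M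
  ... | k , eq | k′ , eq′ = subst₂ _≤_ (sym (ℓ≡size t eq)) (sym (ℓ≡size (suc t) eq′))
    (size-bound 0 (trans eq′ (cong next (sym eq))))

  -- Across the hole: pos 0 lies two steps after pos M.
  ℓ-wrap : ℓ M ≤ suc (ℓ 0)
  ℓ-wrap with pos-hit ≤-refl | pos-hit z≤n
  ... | k , eq | k₀ , eq₀ = subst₂ (λ a b → a ≤ suc b) (sym (ℓ≡size M eq)) (sym (ℓ≡size 0 eq₀))
    (size-bound 1 (begin
    start k₀                ≡⟨ eq₀ ⟩
    next hole               ≡⟨ shift-period (next hole) ⟨
    shift (next hole) (2 + M) ≡⟨ shift-shift (next hole) M 2 ⟨
    shift (pos M) 2         ≡⟨ cong (λ p → shift p 2) eq ⟨
    shift (start k) 2       ∎))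
    where open ≡-Reasoning

  lookup≡A-pos : ∀ t {k} → start k ≡ pos t → lookup L k ≡ A σ (pos t) (ℓ t)
  lookup≡A-pos t {k} eq = trans (lookup≡A k) (cong₂ (A σ) eq (sym (ℓ≡size t eq)))

  ∈G⇔ : ∀ S → S ∈ᶜ G ⇔ ∃ λ t → t ≤ M × S ≡ A σ (pos t) (ℓ t)
  ∈G⇔ S = mk⇔ to from
    where
    to : S ∈ᶜ G → ∃ λ t → t ≤ M × S ≡ A σ (pos t) (ℓ t)
    to S∈G with start-pos (index S∈G)
    ... | t , t≤M , eq = t , t≤M , trans (lookup-index S∈G) (lookup≡A-pos t eq)
    from : (∃ λ t → t ≤ M × S ≡ A σ (pos t) (ℓ t)) → S ∈ᶜ G
    from (t , t≤M , refl) with pos-hit t≤M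
    ... | k , eq = subst (_∈ₗ L) (lookup≡A-pos t eq) (∈-lookup k)

  ℓ-nonconstant : HasTwoSizes G → ℓ M ≢ ℓ 0
  ℓ-nonconstant (S , T , S∈G , T∈G , ∣S∣≢∣T∣) ℓM≡ℓ0 =
    ∣S∣≢∣T∣ (trans (∣∣≡ℓ0 S∈G) (sym (∣∣≡ℓ0 T∈G)))
    where
    ∣∣≡ℓ0 : ∀ {U} → U ∈ᶜ G → ∣ U ∣ ≡ ℓ 0
    ∣∣≡ℓ0 {U} U∈G with Equivalence.to (∈G⇔ U) U∈G
    ... | t , t≤M , refl = trans (∣A∣ σ (pos t) (proj₂ (ℓ-bounds t≤M)))
      (≤-antisym (subst (ℓ t ≤_) ℓM≡ℓ0 (nondecreasing-mono ℓ-nondecreasing t≤M ≤-refl))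
                 (nondecreasing-mono ℓ-nondecreasing z≤n t≤M))

  pairContiguous : ∀ {s} → s < M → (∀ {t} → t ≤ M → ℓ t ≡ pcLength (ℓ 0) s t) → IsPairContiguous G
  pairContiguous {s} s<M profile =
    next hole , ℓ 0 , s , proj₁ (ℓ-bounds z≤n) , 1+ℓ0≤n , s<M , λ S → mk⇔
      (λ S∈G → let t , t≤M , S≡ = Equivalence.to (∈G⇔ S) S∈G in
        t , s≤s t≤M , trans S≡ (A-profile t≤M))
      (λ (t , t<1+M , S≡) → Equivalence.from (∈G⇔ S)
        (t , s≤s⁻¹ t<1+M , trans S≡ (sym (A-profile (s≤s⁻¹ t<1+M)))))
    where
    A-profile : ∀ {t} → t ≤ M → A σ (pos t) (ℓ t) ≡ pcMember σ (next hole) (ℓ 0) s t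
    A-profile {t} t≤M = cong (A σ (pos t)) (profile t≤M)
    1+ℓ0≤n : suc (ℓ 0) ≤ suc (suc M)
    1+ℓ0≤n = subst (_≤ suc (suc M)) (trans (profile ≤-refl) (pcLength-> s<M)) (proj₂ (ℓ-bounds ≤-refl))

lemma3 : (n : ℕ) (σ : Permutation′ n) (G : IntervalCollection σ) →
    IsAntichain G → card G ≡ n ∸ 1 → HasTwoSizes G → IsPairContiguous G
lemma3 zero          σ G _ _      (_ , _ , S∈G , _) = ⊥-elim (¬Fin0 (proj₁ (intervals G S∈G)))
lemma3 (suc zero)    σ G _ card≡0 (_ , _ , S∈G , _) = ⊥-elim (<⇒≢ (∈-length S∈G) (sym card≡0))
lemma3 (suc (suc M)) σ G antichain card≡ two =
  let s , s<M , profile = pcLength-profile ℓ M ℓ-nondecreasing ℓ-wrap (ℓ-nonconstant two)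
  in pairContiguous s<M profile
  where open StartingPositions σ G antichain card≡
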